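{- Let $\mathfrak F$ be a frame satisfying axioms (F1)–(F4). The following are equivalent: (1) $\blacksquare A\subseteq A$ for every $A\in\mathcal G(Z_1)$; (2) $\blacksquare\{y\}'\subseteq\{y\}'$ for every $y\in Z_\partial$; (3) $\boxminus y\le y$ for every $y\in Z_\partial$; (4) $R_\Box\subseteq Z_\partial\times Z_\partial$ is reflexive; (5) $R''_\Box\subseteq Z_1\times Z_1$ is reflexive.
   Context: A frame is a tuple $(Z_1,Z_\partial,I,R_\Box,R_\Diamond,T)$ with $Z_1,Z_\partial$ nonempty, $I\subseteq Z_1\times Z_\partial$, $R_\Box\subseteq Z_\partial\times Z_\partial$, $R_\Diamond\subseteq Z_1\times Z_1$, $T\subseteq Z_\partial\times Z_1\times Z_\partial$. Write $x\nmid y$ iff $(x,y)\notin I$. For $U\subseteq Z_1$, $U'=\{y\in Z_\partial:\forall u\in U\ u\nmid y\}$; for $V\subseteq Z_\partial$, $V'=\{x\in Z_1:\forall v\in V\ x\nmid v\}$ (in particular $\{y\}'=\{x\in Z_1:x\nmid y\}$). $W$ is a Galois set if $W=W''$; stable sets are Galois subsets of $Z_1$, forming $\mathcal G(Z_1)$. On each sort $u\preceq w$ iff $\{u\}'\subseteq\{w\}'$; separated means $\preceq$ is a partial order $\le$; $\Gamma u=\{w:u\le w\}$. For a relation $R$ and tuple $\vec u$, $R\vec u=\{w:wR\vec u\}$, Galois dual $R'$: $wR'\vec u$ iff $w\in(R\vec u)'$; $R$ is smooth if every section of $R'$ is a Galois set. $xR'_\Box v$ iff $\forall y(yR_\Box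 v\Rightarrow x\nmid y)$; $xR''_\Box z$ iff $\forall v(xR'_\Box v\Rightarrow z\nmid v)$. $\blacksquare A=(\{v\in Z_\partial:\exists y\in A'\ vR_\Box y\})'$. Axioms: (F1) separated; (F2) each of $R_\Box,R_\Diamond,T$ is increasing in its first argument and decreasing in each other argument; (F3) for every $v\in Z_\partial,x\in Z_1$, $R_\Box v$, $R_\Diamond x$, $Txv$ are each of the form $\Gamma w$; (F4) $R_\Box,R_\Diamond,T$ are smooth. For $y\in Z_\partial$, $\boxminus y$ denotes the (unique) point with $R_\Box y=\Gamma(\boxminus y)$. -}

module Defs where

open import Level using (Level; suc)
open import Relation.Unary using (Pred; _⊆_; _≐_)
open import Relation.Nullary using (¬_)
open import Relation.Binary.PropositionalEquality using (_≡_)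
open import Data.Product using (Σ; _×_; _,_; proj₁)

-- Raw data of a frame (Z₁, Z∂, I, R□, R◇, T).
-- Convention: a relation R ⊆ S × ... is written with its first argument first,
-- so "w R u⃗" is  R w u⃗ , and the section R u⃗ = {w : w R u⃗}.
record FrameData (ℓ : Level) : Set (suc ℓ) where
  field
    Z₁ : Set ℓ
    Z∂ : Set ℓ
    z₁ : Z₁
    z∂ : Z∂
    I  : Z₁ → Z∂ → Set ℓ
    R□ : Z∂ → Z∂ → Set ℓ
    R◇ : Z₁ → Z₁ → Set ℓ
    T  : Z∂ → Z₁ → Z∂ → Set ℓ

module FrameNotions {ℓ : Level} (D : FrameData ℓ) where
  open FrameData D

  _∤_ : Z₁ → Z∂ → Set ℓ
  x ∤ y = ¬ I x y

  _′₁ : Pred Z₁ ℓ → Pred Z∂ ℓ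
  (U ′₁) y = ∀ u → U u → u ∤ y

  _′∂ : Pred Z∂ ℓ → Pred Z₁ ℓ
  (V ′∂) x = ∀ v → V v → x ∤ v

  ⟪_⟫′₁ : Z₁ → Pred Z∂ ℓ
  ⟪ x ⟫′₁ y = x ∤ y

  ⟪_⟫′∂ : Z∂ → Pred Z₁ ℓ
  ⟪ y ⟫′∂ x = x ∤ y

  Galois₁ : Pred Z₁ ℓ → Set ℓ
  Galois₁ A = A ≐ ((A ′₁) ′∂)

  Galois∂ : Pred Z∂ ℓ → Set ℓ
  Galois∂ V = V ≐ ((V ′∂) ′₁)

  _≤₁_ : Z₁ → Z₁ → Set ℓ
  u ≤₁ w = ⟪ u ⟫′₁ ⊆ ⟪ w ⟫′₁

  _≤∂_ : Z∂ → Z∂ → Set ℓ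
  u ≤∂ w = ⟪ u ⟫′∂ ⊆ ⟪ w ⟫′∂

  Γ₁ : Z₁ → Pred Z₁ ℓ
  Γ₁ u w = u ≤₁ w

  Γ∂ : Z∂ → Pred Z∂ ℓ
  Γ∂ u w = u ≤∂ w

  R□′ : Z₁ → Z∂ → Set ℓ
  R□′ x v = ((λ w → R□ w v) ′∂) x

  R◇′ : Z∂ → Z₁ → Set ℓ
  R◇′ y x = ((λ w → R◇ w x) ′₁) y

  T′ : Z₁ → Z₁ → Z∂ → Set ℓ
  T′ w x v = ((λ u → T u x v) ′∂) w

  R□″ : Z₁ → Z₁ → Set ℓ
  R□″ x z = ∀ v → R□′ x v → z ∤ v

  ■ : Pred Z₁ ℓ → Pred Z₁ ℓ
  ■ A = (λ v → Σ Z∂ λ y → (A ′₁) y × R□ v y) ′∂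

  Separated : Set ℓ
  Separated = (∀ {u w} → u ≤₁ w → w ≤₁ u → u ≡ w)
            × (∀ {u w} → u ≤∂ w → w ≤∂ u → u ≡ w)

  Monotone : Set ℓ
  Monotone =
      (∀ {u u′ v} → u ≤∂ u′ → R□ u v → R□ u′ v)
    × (∀ {u v v′} → v′ ≤∂ v → R□ u v → R□ u v′)
    × (∀ {u u′ x} → u ≤₁ u′ → R◇ u x → R◇ u′ x)
    × (∀ {u x x′} → x′ ≤₁ x → R◇ u x → R◇ u x′)
    × (∀ {u u′ x v} → u ≤∂ u′ → T u x v → T u′ x v)
    × (∀ {u x x′ v} → x′ ≤₁ x → T u x v → T u x′ v)
    × (∀ {u x v v′} → v′ ≤∂ v → T u x v → T u x v′)

  Smooth : Set ℓ
  Smooth =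
      (∀ v → Galois₁ (λ x → R□′ x v))
    × (∀ x → Galois∂ (λ v → R□′ x v))
    × (∀ x → Galois∂ (λ y → R◇′ y x))
    × (∀ y → Galois₁ (λ x → R◇′ y x))
    × (∀ x v → Galois₁ (λ w → T′ w x v))
    × (∀ w v → Galois₁ (λ x → T′ w x v))
    × (∀ w x → Galois∂ (λ v → T′ w x v))

record Frame (ℓ : Level) : Set (suc ℓ) where
  field
    frameData : FrameData ℓ
  open FrameData frameData public
  open FrameNotions frameData public
  field
    F1 : Separated
    F2 : Monotone
    F3□ : ∀ (v : Z∂) → Σ Z∂ λ w → (λ u → R□ u v) ≐ Γ∂ w
    F3◇ : ∀ (x : Z₁) → Σ Z₁ λ w → (λ u → R◇ u x) ≐ Γ₁ w
    F3T : ∀ (x : Z₁) (v : Z∂) → Σ Z∂ λ w → (λ u → T u x v) ≐ Γ∂ w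
    F4 : Smooth

  -- ⊟ y : the point with R□ y = Γ(⊟ y)  (unique by (F1))
  ⊟ : Z∂ → Z∂
  ⊟ y = proj₁ (F3□ y)

{-# OPTIONS --safe #-}
module Submission where

-- By (F3) and antitonicity of R□ in its second argument, ■ sends the basic
-- stable set {y}′ to {⊟ y}′, and the sections of R□′ are the sets {⊟ v}′.
-- Hence (2), (4) and (5) all say that ⊟ y ≤ y for every y, while (1) reduces
-- to (2) because ■ is monotone and every stable set is the intersection of
-- the sets {y}′ containing it. Only these two parts of (F2)/(F3) are used.

open import Defs
open import Level using (Level)
open import Relation.Unary using (Pred; _⊆_; _≐_)
open import Relation.Binary.Definitions using (Reflexive)
open import Data.Product using (_×_; _,_; proj₁; proj₂)
open import Function.Base using (id; _∘_)
open import Function.Bundles using (_⇔_; mk⇔; Equivalence)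
open Equivalence using (to; from)
import Function.Properties.Equivalence as ⇔

module _ {ℓ : Level} (D : FrameData ℓ) where
  open FrameData D
  open FrameNotions D

  ⟪⟫′∂-galois : ∀ y → Galois₁ ⟪ y ⟫′∂
  ⟪⟫′∂-galois y = (λ x∤y v y≤v → y≤v _ x∤y) , (λ x∈A″ → x∈A″ y (λ _ → id))

  ■-mono : ∀ {A B : Pred Z₁ ℓ} → A ⊆ B → ■ A ⊆ ■ B
  ■-mono A⊆B x∈■A v (y , y∈B′ , vR□y) = x∈■A v (y , (λ u → y∈B′ u ∘ A⊆B) , vR□y)

  ■-deflationary⇔■-deflationary-on-⟪⟫′∂ :
    (∀ (A : Pred Z₁ ℓ) → Galois₁ A → ■ A ⊆ A) ⇔ (∀ (y : Z∂) → ■ ⟪ y ⟫′∂ ⊆ ⟪ y ⟫′∂)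
  ■-deflationary⇔■-deflationary-on-⟪⟫′∂ = mk⇔ (λ h y → h ⟪ y ⟫′∂ (⟪⟫′∂-galois y)) on-galois
    where
    on-galois : (∀ y → ■ ⟪ y ⟫′∂ ⊆ ⟪ y ⟫′∂) → ∀ A → Galois₁ A → ■ A ⊆ A
    on-galois h A (_ , A″⊆A) x∈■A =
      A″⊆A λ y y∈A′ → h y (■-mono (λ {u} → y∈A′ u) x∈■A)

module _ {ℓ : Level} (𝔉 : Frame ℓ) where
  open Frame 𝔉

  R□⇔⊟≤∂ : ∀ {u v} → R□ u v ⇔ ⊟ v ≤∂ u
  R□⇔⊟≤∂ {v = v} = mk⇔ (proj₁ (proj₂ (F3□ v))) (proj₂ (proj₂ (F3□ v)))

  ⊟-R□ : ∀ v → R□ (⊟ v) v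
  ⊟-R□ v = from R□⇔⊟≤∂ id

  R□-antitone : ∀ {u v v′} → v′ ≤∂ v → R□ u v → R□ u v′
  R□-antitone = proj₁ (proj₂ F2)

  ■⟪⟫′∂≐⟪⊟⟫′∂ : ∀ y → ■ ⟪ y ⟫′∂ ≐ ⟪ ⊟ y ⟫′∂
  ■⟪⟫′∂≐⟪⊟⟫′∂ y =
      (λ x∈■ → x∈■ (⊟ y) (y , (λ _ → id) , ⊟-R□ y))
    , (λ x∤⊟y v (_ , y≤y′ , vR□y′) → to R□⇔⊟≤∂ (R□-antitone (λ {u} → y≤y′ u) vR□y′) x∤⊟y)

  R□′-section≐⟪⊟⟫′∂ : ∀ v → (λ x → R□′ x v) ≐ ⟪ ⊟ v ⟫′∂
  R□′-section≐⟪⊟⟫′∂ v =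
      (λ x∈R□′ → x∈R□′ (⊟ v) (⊟-R□ v))
    , (λ x∤⊟v u uR□v → to R□⇔⊟≤∂ uR□v x∤⊟v)

  ■-deflationary-on-⟪⟫′∂⇔⊟-deflationary :
    (∀ y → ■ ⟪ y ⟫′∂ ⊆ ⟪ y ⟫′∂) ⇔ (∀ y → ⊟ y ≤∂ y)
  ■-deflationary-on-⟪⟫′∂⇔⊟-deflationary = mk⇔
    (λ h y {x} x∤⊟y → h y (proj₂ (■⟪⟫′∂≐⟪⊟⟫′∂ y) x∤⊟y))
    (λ h y {x} x∈■ → h y (proj₁ (■⟪⟫′∂≐⟪⊟⟫′∂ y) x∈■))

  ⊟-deflationary⇔R□-reflexive : (∀ y → ⊟ y ≤∂ y) ⇔ Reflexive R□
  ⊟-deflationary⇔R□-reflexive = mk⇔ (λ h {y} → from R□⇔⊟≤∂ (h y)) (λ r y {x} → to R□⇔⊟≤∂ r {x})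

  R□″-reflexive⇔⊟-deflationary : Reflexive R□″ ⇔ (∀ y → ⊟ y ≤∂ y)
  R□″-reflexive⇔⊟-deflationary = mk⇔
    (λ r y {x} x∤⊟y → r y (proj₂ (R□′-section≐⟪⊟⟫′∂ y) x∤⊟y))
    (λ h {x} v x∈R□′ → h v (proj₁ (R□′-section≐⟪⊟⟫′∂ v) x∈R□′))

proposition5p4 : ∀ {ℓ : Level} (𝔉 : Frame ℓ) → let open Frame 𝔉 in
    ((∀ (A : Pred Z₁ ℓ) → Galois₁ A → ■ A ⊆ A) ⇔ (∀ (y : Z∂) → ■ ⟪ y ⟫′∂ ⊆ ⟪ y ⟫′∂))
    × ((∀ (y : Z∂) → ■ ⟪ y ⟫′∂ ⊆ ⟪ y ⟫′∂) ⇔ (∀ (y : Z∂) → ⊟ y ≤∂ y))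
    × ((∀ (y : Z∂) → ⊟ y ≤∂ y) ⇔ Reflexive R□)
    × (Reflexive R□ ⇔ Reflexive R□″)
proposition5p4 𝔉 =
    ■-deflationary⇔■-deflationary-on-⟪⟫′∂ (Frame.frameData 𝔉)
  , ■-deflationary-on-⟪⟫′∂⇔⊟-deflationary 𝔉
  , ⊟-deflationary⇔R□-reflexive 𝔉
  , ⇔.trans (⇔.sym (⊟-deflationary⇔R□-reflexive 𝔉)) (⇔.sym (R□″-reflexive⇔⊟-deflationary 𝔉))
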